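{- Let $\phi=(1+\sqrt5)/2$ and for $k\ge1$ let $A(k,3)=\sum_{n=1}^{F_k-1}\lfloor\phi n\rfloor^3$. Then for every integer $k\ge1$, $$A(2k,3)=\frac14(F_{2k-1}-1)(F_{2k+1}-1)^2(F_{2k+2}-1)$$ and $$A(2k-1,3)=\frac14(F_{2k-1}-1)(F_{2k}-1)\cdot\frac15\bigl(L_{4k}-3L_{2k+1}-L_{2k}+3\bigr).$$
   Context: $\lfloor x\rfloor$ denotes the integer part of $x$; an empty sum is $0$. The Fibonacci numbers $F_n$ and Lucas numbers $L_n$ are defined by $F_0=0$, $F_1=1$, $L_0=2$, $L_1=1$ and $F_{n+2}=F_{n+1}+F_n$, $L_{n+2}=L_{n+1}+L_n$ for $n\ge0$. -}

module Defs where

open import Data.Nat using (ℕ; zero; suc; _+_; _*_; _∸_; _^_; _≤_; _<_)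
open import Data.Integer as ℤ using (ℤ)

fib : ℕ → ℕ
fib 0 = 0
fib 1 = 1
fib (suc (suc n)) = fib (suc n) + fib n

lucas : ℕ → ℕ
lucas 0 = 2
lucas 1 = 1
lucas (suc (suc n)) = lucas (suc n) + lucas n

-- IsFloorPhi n m  :⇔  m = ⌊φ n⌋, i.e.  m ≤ φ n < m + 1  with φ = (1+√5)/2.
-- Over ℕ:  m ≤ φ n  ⇔  2m - n ≤ √5 n  ⇔  (2m ∸ n)² ≤ 5 n²
--          φ n < m+1 ⇔  n + √5 n < 2m + 2  ⇔  5 n² < (2m + 2 ∸ n)²
IsFloorPhi : ℕ → ℕ → Set
IsFloorPhi n m = ((2 * m ∸ n) ^ 2 ≤ 5 * n ^ 2) × (5 * n ^ 2 < (2 * m + 2 ∸ n) ^ 2)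
  where open import Data.Product using (_×_)

sumFrom1 : (ℕ → ℤ) → ℕ → ℤ
sumFrom1 g zero = ℤ.+ 0
sumFrom1 g (suc N) = sumFrom1 g N ℤ.+ g (suc N)

A3 : (ℕ → ℕ) → ℕ → ℤ
A3 f k = sumFrom1 (λ n → ℤ.+ (f n ^ 3)) (fib k ∸ 1)

Fz : ℕ → ℤ
Fz n = ℤ.+ fib n

Lz : ℕ → ℤ
Lz n = ℤ.+ lucas n

{-# OPTIONS --safe #-}
module Submission where

-- Let N(c, n) = c² − cn − n² be the norm of c − nφ. For c, n ≥ 0, c ≤ φn iff N(c, n) ≤ 0, so
-- c = ⌊φn⌋ iff N(c, n) ≤ 0 < N(c + 1, n); and N(c, n) ≠ 0 for n > 0 because φ is irrational.
-- Cassini's identity N(F (j + 1), F j) = (−1)ʲ makes F (j + 1) / F j a best approximation of φ,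
-- which yields ⌊φ(F j + m)⌋ = ⌊φm⌋ + F (j + 1) for 0 < m < F j and ⌊φ F j⌋ = F (j + 1) − [j even].
-- Splitting 0 < n < F (k + 2) at n = F (k + 1) thus expresses the power sums Σ ⌊φn⌋ᵖ (p ≤ 3) at k + 2
-- through those at k and k + 1, and closed forms in F k, F (k + 1) and the parity of k follow by
-- induction, each step being a polynomial identity modulo Cassini's identity.

open import Defs
open import Data.Nat using (ℕ)
open import Data.Empty using (⊥-elim)
open import Data.Product using (_×_; _,_; proj₁; proj₂)
open import Data.Sum using (_⊎_; inj₁; inj₂)
open import Relation.Nullary using (yes; no)
open import Relation.Binary.PropositionalEquality
  using (_≡_; _≢_; ≢-sym; refl; sym; trans; cong; cong₂; subst; subst₂; module ≡-Reasoning)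

module Irrationality where
  open import Data.Nat using (_+_; _*_; _∸_; _≤_; _<_)
  open import Data.Nat.Properties
  open import Data.Nat.Induction using (<-wellFounded)
  open import Data.Nat.Tactic.RingSolver using (solve-∀)
  open import Induction.WellFounded using (Acc; acc)

  -- Euclid's descent: c² = cm + m² with c = m + d forces m² = md + d², with m < c.
  φ-irrational : ∀ c m → 1 ≤ m → c * c ≢ c * m + m * m
  φ-irrational c m = descent c (<-wellFounded c) m
    where
    descent : ∀ c → Acc _<_ c → ∀ m → 1 ≤ m → c * c ≢ c * m + m * m
    descent c (acc smaller) m 1≤m eq with ≤-<-connex c m
    ... | inj₁ c≤m = <-irrefl eq (≤-<-trans (*-monoʳ-≤ c c≤m) (m<m+n (c * m) (*-mono-≤ 1≤m 1≤m)))
    ... | inj₂ m<c = descent m (smaller m<c) d (m<n⇒0<n∸m m<c) (+-cancelˡ-≡ (m * m + m * d) _ _ expand)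
      where
      d = c ∸ m
      c≡m+d : c ≡ m + d
      c≡m+d = sym (m+[n∸m]≡n (<⇒≤ m<c))
      expand : m * m + m * d + m * m ≡ m * m + m * d + (m * d + d * d)
      expand = begin
        m * m + m * d + m * m   ≡⟨ square-step m d ⟩
        (m + d) * m + m * m     ≡⟨ cong (λ x → x * m + m * m) c≡m+d ⟨
        c * m + m * m           ≡⟨ eq ⟨
        c * c                   ≡⟨ cong (λ x → x * x) c≡m+d ⟩
        (m + d) * (m + d)       ≡⟨ square-expand m d ⟩
        m * m + m * d + (m * d + d * d) ∎
        where
        open ≡-Reasoning
        square-step : ∀ m d → m * m + m * d + m * m ≡ (m + d) * m + m * m
        square-step = solve-∀
        square-expand : ∀ m d → (m + d) * (m + d) ≡ m * m + m * d + (m * d + d * d)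
        square-expand = solve-∀

module Casts where
  open import Data.Nat as ℕ using (ℕ; zero; suc)
  open import Data.Integer using (+_; _-_; _*_; _^_)
  open import Data.Integer.Properties using (pos-*; m-n≡m⊖n; ⊖-≥)

  pos-∸ : ∀ {m n} → n ℕ.≤ m → + (m ℕ.∸ n) ≡ + m - + n
  pos-∸ {m} {n} n≤m = sym (trans (m-n≡m⊖n m n) (⊖-≥ n≤m))

  pos-^ : ∀ x k → + (x ℕ.^ k) ≡ (+ x) ^ k
  pos-^ x zero    = refl
  pos-^ x (suc k) = trans (pos-* x (x ℕ.^ k)) (cong (λ y → + x * y) (pos-^ x k))

module NormForm where
  open import Data.Nat as ℕ using (ℕ; z≤n)
  open import Data.Integer
    using (ℤ; +_; -[1+_]; 0ℤ; 1ℤ; -1ℤ; _+_; _-_; _*_; -_; _≤_; _<_; _≤?_; _<?_; +≤+; +<+)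
  open import Data.Integer.Properties
  open import Data.Integer.Tactic.RingSolver using (solve-∀)
  open Irrationality using (φ-irrational)

  norm : ℤ → ℤ → ℤ
  norm x y = x * x - x * y - y * y
  -- Inlining lets solve-∀ see through norm (and Φ₁, Φ₂, Φ₃ below) in ring identities.
  {-# INLINE norm #-}

  -- Multiplication by φ maps x − yφ to (x + y) − xφ and has norm −1.
  norm-rotate : ∀ x y → norm (x + y) x ≡ - norm x y
  norm-rotate = solve-∀

  nonneg : ∀ n → 0ℤ ≤ + n
  nonneg _ = +≤+ z≤n

  +-nonneg : ∀ {x y} → 0ℤ ≤ x → 0ℤ ≤ y → 0ℤ ≤ x + y
  +-nonneg = +-mono-≤

  *-nonneg : ∀ {x y} → 0ℤ ≤ x → 0ℤ ≤ y → 0ℤ ≤ x * y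
  *-nonneg (+≤+ {n = m} _) (+≤+ {n = n} _) = subst (0ℤ ≤_) (pos-* m n) (+≤+ z≤n)

  square-nonneg : ∀ x → 0ℤ ≤ x * x
  square-nonneg (+ n)    = *-nonneg (nonneg n) (nonneg n)
  square-nonneg -[1+ n ] = nonneg _

  0≤-⇒≤0 : ∀ {x} → 0ℤ ≤ - x → x ≤ 0ℤ
  0≤-⇒≤0 {x} 0≤-x = subst (_≤ 0ℤ) (neg-involutive x) (neg-mono-≤ 0≤-x)

  ≤0⇒0≤- : ∀ {x} → x ≤ 0ℤ → 0ℤ ≤ - x
  ≤0⇒0≤- = neg-mono-≤

  0≤⇒≢-1 : ∀ {x} → 0ℤ ≤ x → x ≢ -1ℤ
  0≤⇒≢-1 (+≤+ _) ()

  square-≤⇒≤ : ∀ {x y} → 0ℤ ≤ y → 0ℤ ≤ y * y - x * x → x ≤ y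
  square-≤⇒≤ {x} {y} 0≤y 0≤y²-x² with x ≤? y
  ... | yes x≤y = x≤y
  ... | no  x≰y = ⊥-elim (0≤⇒≢-1 (+-nonneg 0≤y²-x² (+-nonneg (+-nonneg (*-nonneg 0≤d 0≤d+2y) 0≤d) 0≤d+2y))
                                    (identity x y))
    where
    0≤d : 0ℤ ≤ x - (1ℤ + y)
    0≤d = i≤j⇒0≤j-i (i<j⇒suc[i]≤j (≰⇒> x≰y))
    0≤d+2y : 0ℤ ≤ x - (1ℤ + y) + + 2 * y
    0≤d+2y = +-nonneg 0≤d (*-nonneg (nonneg 2) 0≤y)
    -- with d = x − y − 1 ≥ 0, y² − x² = −(1 + d)(1 + d + 2y)
    identity : ∀ x y → y * y - x * x
                         + ((x - (1ℤ + y)) * (x - (1ℤ + y) + + 2 * y) + (x - (1ℤ + y))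
                           + (x - (1ℤ + y) + + 2 * y))
                       ≡ -1ℤ
    identity = solve-∀

  -- As (2c − m)² = 4 N(c, m) + 5m², squaring bounds the cross term by the two norms.
  cross : ℤ → ℤ → ℤ → ℤ → ℤ
  cross c m p q = + 5 * m * q - (+ 2 * c - m) * (+ 2 * p - q)
  {-# INLINE cross #-}

  norm-+ : ∀ c m p q → + 2 * norm (c + p) (m + q) ≡ + 2 * norm c m + + 2 * norm p q - cross c m p q
  norm-+ = solve-∀

  cross-nonneg : ∀ {c m p q} → 0ℤ ≤ m → 0ℤ ≤ q → norm c m ≤ 0ℤ → norm p q ≤ 0ℤ →
                 0ℤ ≤ cross c m p q
  cross-nonneg {c} {m} {p} {q} 0≤m 0≤q Ncm≤0 Npq≤0 =
    i≤j⇒0≤j-i (square-≤⇒≤ (*-nonneg (*-nonneg (nonneg 5) 0≤m) 0≤q)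
      (subst (0ℤ ≤_) (sym (identity c m p q))
        (+-nonneg (*-nonneg (*-nonneg (nonneg 20) (square-nonneg m)) (≤0⇒0≤- Npq≤0))
                  (*-nonneg (*-nonneg (nonneg 4) (square-nonneg (+ 2 * p - q))) (≤0⇒0≤- Ncm≤0)))))
    where
    identity : ∀ c m p q → + 5 * m * q * (+ 5 * m * q) - (+ 2 * c - m) * (+ 2 * p - q) * ((+ 2 * c - m) * (+ 2 * p - q))
                         ≡ + 20 * (m * m) * - norm p q + + 4 * ((+ 2 * p - q) * (+ 2 * p - q)) * - norm c m
    identity = solve-∀

  cross-≥ : ∀ {c m p q} → 0ℤ ≤ m → m ≤ q → norm c m ≤ -1ℤ → norm p q ≡ 1ℤ →
            0ℤ ≤ cross c m p q - + 2 * (norm c m + 1ℤ)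
  cross-≥ {c} {m} {p} {q} 0≤m m≤q Ncm≤-1 Npq≡1 =
    subst (0ℤ ≤_) (sym (rearrange c m p q))
      (i≤j⇒0≤j-i (square-≤⇒≤ (+-nonneg (*-nonneg (*-nonneg (nonneg 5) 0≤m) 0≤q) (*-nonneg (nonneg 2) 0≤s))
        (subst (0ℤ ≤_) (sym (identity c m p q))
          (+-nonneg (+-nonneg (+-nonneg (+-nonneg (+-nonneg
            (*-nonneg (*-nonneg (nonneg 20) 0≤s) (+-nonneg (*-nonneg 0≤m 0≤q) (*-nonneg 0≤q 0≤q)))
            (*-nonneg (*-nonneg (nonneg 4) 0≤s) 0≤s))
            (*-nonneg (nonneg 16) 0≤s))
            (*-nonneg (*-nonneg (nonneg 20) (i≤j⇒0≤j-i m≤q)) (+-nonneg 0≤q 0≤m)))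
            (nonneg 16))
            (*-nonneg (*-nonneg (nonneg 4) (square-nonneg (+ 2 * c - m))) (i≤j⇒0≤j-i (≤-reflexive Npq≡1)))))))
    where
    0≤q = ≤-trans 0≤m m≤q
    0≤s : 0ℤ ≤ -1ℤ - norm c m
    0≤s = i≤j⇒0≤j-i Ncm≤-1
    rearrange : ∀ c m p q → cross c m p q - + 2 * (norm c m + 1ℤ)
                          ≡ + 5 * m * q + + 2 * (-1ℤ - norm c m) - (+ 2 * c - m) * (+ 2 * p - q)
    rearrange = solve-∀
    identity : ∀ c m p q →
      (+ 5 * m * q + + 2 * (-1ℤ - norm c m)) * (+ 5 * m * q + + 2 * (-1ℤ - norm c m))
        - (+ 2 * c - m) * (+ 2 * p - q) * ((+ 2 * c - m) * (+ 2 * p - q))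
      ≡ + 20 * (-1ℤ - norm c m) * (m * q + q * q) + + 4 * (-1ℤ - norm c m) * (-1ℤ - norm c m)
        + + 16 * (-1ℤ - norm c m) + + 20 * (q - m) * (q + m) + + 16
        + + 4 * ((+ 2 * c - m) * (+ 2 * c - m)) * (1ℤ - norm p q)
    identity = solve-∀

  2*≤0⇒≤0 : ∀ {x} → + 2 * x ≤ 0ℤ → x ≤ 0ℤ
  2*≤0⇒≤0 {x} = *-cancelˡ-≤-pos x 0ℤ (+ 2)

  norm-+-≤0 : ∀ {c m p q} → 0ℤ ≤ m → 0ℤ ≤ q → norm c m ≤ 0ℤ → norm p q ≤ 0ℤ →
              norm (c + p) (m + q) ≤ 0ℤ
  norm-+-≤0 {c} {m} {p} {q} 0≤m 0≤q Ncm≤0 Npq≤0 = 2*≤0⇒≤0 (begin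
    + 2 * norm (c + p) (m + q)                        ≡⟨ norm-+ c m p q ⟩
    + 2 * norm c m + + 2 * norm p q - cross c m p q   ≤⟨ +-mono-≤ (+-mono-≤ (*-monoˡ-≤-nonNeg (+ 2) Ncm≤0)
                                                                          (*-monoˡ-≤-nonNeg (+ 2) Npq≤0))
                                                                 (neg-mono-≤ cross≥0) ⟩
    0ℤ                                                ∎)
    where
    open ≤-Reasoning
    cross≥0 = cross-nonneg {c} {m} {p} {q} 0≤m 0≤q Ncm≤0 Npq≤0

  -- A fraction p/q just above φ (N(p, q) = 1) is closer to φ than any c/m below it with m ≤ q.
  norm-+-≤0-convergent : ∀ {c m p q} → 0ℤ ≤ m → m ≤ q → norm c m ≤ -1ℤ → norm p q ≡ 1ℤ →
                         norm (c + p) (m + q) ≤ 0ℤ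
  norm-+-≤0-convergent {c} {m} {p} {q} 0≤m m≤q Ncm≤-1 Npq≡1 = 2*≤0⇒≤0 (begin
    + 2 * norm (c + p) (m + q)                        ≡⟨ norm-+ c m p q ⟩
    + 2 * norm c m + + 2 * norm p q - cross c m p q   ≡⟨ cong (λ e → + 2 * norm c m + + 2 * e - cross c m p q) Npq≡1 ⟩
    + 2 * norm c m + + 2 * 1ℤ - cross c m p q         ≡⟨ rearrange c m p q ⟩
    - (cross c m p q - + 2 * (norm c m + 1ℤ))         ≤⟨ neg-mono-≤ (cross-≥ {c} {m} {p} {q} 0≤m m≤q Ncm≤-1 Npq≡1)
                                                       ⟩
    0ℤ                                                ∎)
    where
    open ≤-Reasoning
    rearrange : ∀ c m p q → + 2 * norm c m + + 2 * 1ℤ - cross c m p q ≡ - (cross c m p q - + 2 * (norm c m + 1ℤ))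
    rearrange = solve-∀

  norm-pos⇒< : ∀ {y n} → 0ℤ ≤ y → 0ℤ < norm y n → n < y
  norm-pos⇒< {y} {n} 0≤y 0<N with n <? y
  ... | yes n<y = n<y
  ... | no  n≮y = ⊥-elim (<⇒≱ 0<N (0≤-⇒≤0 (subst (0ℤ ≤_) (sym (identity y n))
                    (+-nonneg (*-nonneg 0≤y (i≤j⇒0≤j-i (≮⇒≥ n≮y))) (square-nonneg n)))))
    where
    identity : ∀ y n → - norm y n ≡ y * (n - y) + n * n
    identity = solve-∀

  norm-monoˡ-≤ : ∀ {x y n} → 0ℤ ≤ n → n ≤ x → x ≤ y → norm x n ≤ norm y n
  norm-monoˡ-≤ {x} {y} {n} 0≤n n≤x x≤y = 0≤i-j⇒j≤i (subst (0ℤ ≤_) (sym (identity x y n))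
    (*-nonneg 0≤y-x (+-nonneg (+-nonneg 0≤y-x (*-nonneg (nonneg 2) (i≤j⇒0≤j-i n≤x))) 0≤n)))
    where
    0≤y-x = i≤j⇒0≤j-i x≤y
    identity : ∀ x y n → norm y n - norm x n ≡ (y - x) * ((y - x) + + 2 * (x - n) + n)
    identity = solve-∀

  norm-separates : ∀ {x y n} → 0ℤ ≤ n → 0ℤ ≤ y → norm x n ≤ 0ℤ → 0ℤ < norm y n → x < y
  norm-separates {x} {y} {n} 0≤n 0≤y Nx≤0 0<Ny with x <? y
  ... | yes x<y = x<y
  ... | no  x≮y =
    ⊥-elim (<⇒≱ 0<Ny (≤-trans (norm-monoˡ-≤ 0≤n (<⇒≤ (norm-pos⇒< 0≤y 0<Ny)) (≮⇒≥ x≮y)) Nx≤0))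

  norm≢0 : ∀ {x y} → 0ℤ ≤ x → 0ℤ < y → norm x y ≢ 0ℤ
  norm≢0 (+≤+ {n = c} _) (+<+ {n = m} 0<m) N≡0 = φ-irrational c m 0<m (+-injective (begin
    + (c ℕ.* c)                  ≡⟨ pos-* c c ⟩
    + c * + c                    ≡⟨ identity (+ c) (+ m) ⟩
    norm (+ c) (+ m) + (+ c * + m + + m * + m)  ≡⟨ cong (_+ (+ c * + m + + m * + m)) N≡0 ⟩
    0ℤ + (+ c * + m + + m * + m)                ≡⟨ +-identityˡ _ ⟩
    + c * + m + + m * + m        ≡⟨ cong₂ _+_ (pos-* c m) (pos-* m m) ⟨
    + (c ℕ.* m) + + (m ℕ.* m)    ≡⟨ pos-+ (c ℕ.* m) (m ℕ.* m) ⟨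
    + (c ℕ.* m ℕ.+ m ℕ.* m)      ∎))
    where
    open ≡-Reasoning
    identity : ∀ x y → x * x ≡ norm x y + (x * y + y * y)
    identity = solve-∀

  0≤norm⇒0<norm : ∀ {x n} → 0ℤ ≤ x → 0ℤ < n → 0ℤ ≤ norm x n → 0ℤ < norm x n
  0≤norm⇒0<norm {x} {n} 0≤x 0<n 0≤N = ≤∧≢⇒< 0≤N (≢-sym (norm≢0 0≤x 0<n))

  norm-≤0-monoʳ : ∀ {c m n} → 0ℤ ≤ m → m ≤ n → norm c m ≤ 0ℤ → norm c n ≤ 0ℤ
  norm-≤0-monoʳ {c} {m} {n} 0≤m m≤n Ncm≤0 =
    subst (_≤ 0ℤ) (cong₂ norm (+-identityʳ c) (regroup m n))
      (norm-+-≤0 {c} {m} {0ℤ} {n - m} 0≤m (i≤j⇒0≤j-i m≤n) Ncm≤0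
        (0≤-⇒≤0 (subst (0ℤ ≤_) (identity (n - m)) (square-nonneg (n - m)))))
    where
    regroup : ∀ m n → m + (n - m) ≡ n
    regroup = solve-∀
    identity : ∀ k → k * k ≡ - norm 0ℤ k
    identity = solve-∀

  -- Rotation by φ exchanges the two sides of φ, so the results below φ transfer to above φ.
  rotated-≤0⇒≥0 : ∀ c m p q → norm (c + m + (p + q)) (c + p) ≤ 0ℤ → 0ℤ ≤ norm (c + p) (m + q)
  rotated-≤0⇒≥0 c m p q N≤0 = subst (0ℤ ≤_) (neg-involutive _)
    (≤0⇒0≤- (subst (_≤ 0ℤ) (trans (cong (λ x → norm x (c + p)) (regroup c m p q)) (norm-rotate (c + p) (m + q)))
                           N≤0))
    where
    regroup : ∀ c m p q → c + m + (p + q) ≡ c + p + (m + q)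
    regroup = solve-∀

  norm-+-≥0 : ∀ {c m p q} → 0ℤ ≤ c → 0ℤ ≤ p → 0ℤ ≤ norm c m → 0ℤ ≤ norm p q →
              0ℤ ≤ norm (c + p) (m + q)
  norm-+-≥0 {c} {m} {p} {q} 0≤c 0≤p 0≤Ncm 0≤Npq = rotated-≤0⇒≥0 c m p q
    (norm-+-≤0 {c + m} {c} {p + q} {p} 0≤c 0≤p (rotate-≤0 c m 0≤Ncm) (rotate-≤0 p q 0≤Npq))
    where
    rotate-≤0 : ∀ x y → 0ℤ ≤ norm x y → norm (x + y) x ≤ 0ℤ
    rotate-≤0 x y 0≤N = subst (_≤ 0ℤ) (sym (norm-rotate x y)) (neg-mono-≤ 0≤N)

  -- A fraction p/q just below φ (N(p, q) = −1) is closer to φ than any c/m above it with c ≤ p.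
  norm-+-≥0-convergent : ∀ {c m p q} → 0ℤ ≤ c → c ≤ p → 1ℤ ≤ norm c m → norm p q ≡ -1ℤ →
                         0ℤ ≤ norm (c + p) (m + q)
  norm-+-≥0-convergent {c} {m} {p} {q} 0≤c c≤p 1≤Ncm Npq≡-1 = rotated-≤0⇒≥0 c m p q
    (norm-+-≤0-convergent {c + m} {c} {p + q} {p} 0≤c c≤p
      (subst (_≤ -1ℤ) (sym (norm-rotate c m)) (neg-mono-≤ 1≤Ncm))
      (trans (norm-rotate p q) (cong -_ Npq≡-1)))

module Fibonacci where
  open import Data.Nat as ℕ using (ℕ; zero; suc; z≤n; s≤s)
  import Data.Nat.Properties as ℕ
  open import Data.Integer using (ℤ; +_; 0ℤ; 1ℤ; _+_; _-_; _*_; -_)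
  open import Data.Integer.Properties using (pos-+)
  open import Data.Integer.Tactic.RingSolver using (solve-∀)
  open NormForm using (norm; norm-rotate)
  open ≡-Reasoning

  fib-mono : ∀ n → fib n ℕ.≤ fib (suc n)
  fib-mono zero    = z≤n
  fib-mono (suc n) = ℕ.m≤m+n (fib (suc n)) (fib n)

  1≤fib[1+n] : ∀ n → 1 ℕ.≤ fib (suc n)
  1≤fib[1+n] zero    = s≤s z≤n
  1≤fib[1+n] (suc n) = ℕ.≤-trans (1≤fib[1+n] n) (fib-mono (suc n))

  Fz-rec : ∀ n → Fz (suc (suc n)) ≡ Fz (suc n) + Fz n
  Fz-rec n = pos-+ (fib (suc n)) (fib n)

  parity : ℕ → ℤ
  parity zero    = 0ℤ
  parity (suc n) = 1ℤ - parity n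

  parity-idem : ∀ n → parity n * parity n - parity n ≡ 0ℤ
  parity-idem zero    = refl
  parity-idem (suc n) = trans (identity (parity n)) (parity-idem n)
    where
    identity : ∀ h → (1ℤ - h) * (1ℤ - h) - (1ℤ - h) ≡ h * h - h
    identity = solve-∀

  parity-cases : ∀ n → parity n ≡ 0ℤ ⊎ parity n ≡ 1ℤ
  parity-cases zero    = inj₁ refl
  parity-cases (suc n) with parity-cases n
  ... | inj₁ h≡0 = inj₂ (cong (λ h → 1ℤ - h) h≡0)
  ... | inj₂ h≡1 = inj₁ (cong (λ h → 1ℤ - h) h≡1)

  parity-2* : ∀ k → parity (2 ℕ.* k) ≡ 0ℤ
  parity-2* zero    = refl
  parity-2* (suc k) = trans (cong parity (ℕ.*-suc 2 k)) (cong (λ h → 1ℤ - (1ℤ - h)) (parity-2* k))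

  parity-pred : ∀ n → parity (suc n) ≡ 0ℤ → parity n ≡ 1ℤ
  parity-pred n h′≡0 with parity-cases n
  ... | inj₂ h≡1 = h≡1
  ... | inj₁ h≡0 with trans (sym (cong (λ h → 1ℤ - h) h≡0)) h′≡0
  ...   | ()

  cassini : ∀ n → norm (Fz (suc n)) (Fz n) ≡ 1ℤ - + 2 * parity n
  cassini zero    = refl
  cassini (suc n) = begin
    norm (Fz (suc (suc n))) (Fz (suc n))        ≡⟨ cong (λ x → norm x (Fz (suc n))) (Fz-rec n) ⟩
    norm (Fz (suc n) + Fz n) (Fz (suc n))       ≡⟨ norm-rotate (Fz (suc n)) (Fz n) ⟩
    - norm (Fz (suc n)) (Fz n)                  ≡⟨ cong -_ (cassini n) ⟩
    - (1ℤ - + 2 * parity n)                     ≡⟨ identity (parity n) ⟩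
    1ℤ - + 2 * (1ℤ - parity n)                  ∎
    where
    identity : ∀ h → - (1ℤ - + 2 * h) ≡ 1ℤ - + 2 * (1ℤ - h)
    identity = solve-∀

  Fz-+ : ∀ m n → Fz (suc (m ℕ.+ n)) ≡ Fz (suc m) * Fz (suc n) + Fz m * Fz n
  Fz-+ zero    n = identity (Fz (suc n)) (Fz n)
    where
    identity : ∀ x y → x ≡ 1ℤ * x + 0ℤ * y
    identity = solve-∀
  Fz-+ (suc m) n = begin
    Fz (suc (suc (m ℕ.+ n)))                      ≡⟨ cong (λ k → Fz (suc k)) (ℕ.+-suc m n) ⟨
    Fz (suc (m ℕ.+ suc n))                        ≡⟨ Fz-+ m (suc n) ⟩
    Fz (suc m) * Fz (suc (suc n)) + Fz m * Fz (suc n)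
                                                  ≡⟨ cong (λ x → Fz (suc m) * x + Fz m * Fz (suc n)) (Fz-rec n) ⟩
    Fz (suc m) * (Fz (suc n) + Fz n) + Fz m * Fz (suc n)
                                                  ≡⟨ identity (Fz (suc m)) (Fz m) (Fz (suc n)) (Fz n) ⟩
    (Fz (suc m) + Fz m) * Fz (suc n) + Fz (suc m) * Fz n
                                                  ≡⟨ cong (λ x → x * Fz (suc n) + Fz (suc m) * Fz n) (Fz-rec m) ⟨
    Fz (suc (suc m)) * Fz (suc n) + Fz (suc m) * Fz n ∎
    where
    identity : ∀ a b c d → a * (c + d) + b * c ≡ (a + b) * c + a * d
    identity = solve-∀

  Lz≡2Fz-Fz : ∀ n → Lz n ≡ + 2 * Fz (suc n) - Fz n
  Lz≡2Fz-Fz zero          = refl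
  Lz≡2Fz-Fz (suc zero)    = refl
  Lz≡2Fz-Fz (suc (suc n)) = begin
    Lz (suc (suc n))                                          ≡⟨ pos-+ (lucas (suc n)) (lucas n) ⟩
    Lz (suc n) + Lz n                                         ≡⟨ cong₂ _+_ (Lz≡2Fz-Fz (suc n)) (Lz≡2Fz-Fz n) ⟩
    + 2 * Fz (suc (suc n)) - Fz (suc n) + (+ 2 * Fz (suc n) - Fz n)
                                          ≡⟨ identity (Fz (suc (suc n))) (Fz (suc n)) (Fz n) ⟩
    + 2 * (Fz (suc (suc n)) + Fz (suc n)) - (Fz (suc n) + Fz n)
                                          ≡⟨ cong₂ (λ x y → + 2 * x - y) (Fz-rec (suc n)) (Fz-rec n) ⟨
    + 2 * Fz (suc (suc (suc n))) - Fz (suc (suc n))           ∎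
    where
    identity : ∀ a b c → + 2 * a - b + (+ 2 * b - c) ≡ + 2 * (a + b) - (b + c)
    identity = solve-∀


module GoldenFloor where
  open import Data.Nat as ℕ using (ℕ; suc; z≤n; s≤s)
  import Data.Nat.Properties as ℕ
  import Data.Nat.Tactic.RingSolver as ℕ-Solver
  open import Data.Integer using (ℤ; +_; 0ℤ; 1ℤ; -1ℤ; _+_; _-_; _*_; -_; _≤_; _<_; +≤+; -≤+; +<+)
  open import Data.Integer.Properties
  open import Data.Integer.Tactic.RingSolver using (solve-∀)
  open Casts using (pos-∸)
  open NormForm

  IsNormFloor : ℤ → ℤ → Set
  IsNormFloor n c = norm c n ≤ 0ℤ × 0ℤ < norm (1ℤ + c) n

  isFloorPhi⇒≤ : ∀ {n c} → IsFloorPhi n c → n ℕ.≤ c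
  isFloorPhi⇒≤ {n} {c} (_ , upper) with n ℕ.≤? c
  ... | yes n≤c = n≤c
  ... | no  n≰c = ⊥-elim (ℕ.<⇒≱ upper (ℕ.≤-trans (ℕ.^-monoˡ-≤ 2 small) (ℕ.m≤n*m (n ℕ.^ 2) 5)))
    where
    small : 2 ℕ.* c ℕ.+ 2 ℕ.∸ n ℕ.≤ n
    small = begin
      2 ℕ.* c ℕ.+ 2 ℕ.∸ n   ≡⟨ cong (ℕ._∸ n) (double-suc c) ⟩
      suc c ℕ.+ suc c ℕ.∸ n ≤⟨ ℕ.∸-monoˡ-≤ n (ℕ.+-mono-≤ (ℕ.≰⇒> n≰c) (ℕ.≰⇒> n≰c)) ⟩
      n ℕ.+ n ℕ.∸ n         ≡⟨ ℕ.m+n∸n≡m n n ⟩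
      n                     ∎
      where
      open ℕ.≤-Reasoning
      double-suc : ∀ c → 2 ℕ.* c ℕ.+ 2 ≡ suc c ℕ.+ suc c
      double-suc = ℕ-Solver.solve-∀

  pos-∸-square : ∀ {a n} {x} → n ℕ.≤ a → + a ≡ x → + ((a ℕ.∸ n) ℕ.^ 2) ≡ (x - + n) * (x - + n)
  pos-∸-square {a} {n} {x} n≤a a≡x = begin
    + ((a ℕ.∸ n) ℕ.* ((a ℕ.∸ n) ℕ.* 1))   ≡⟨ cong (λ k → + ((a ℕ.∸ n) ℕ.* k)) (ℕ.*-identityʳ (a ℕ.∸ n)) ⟩
    + ((a ℕ.∸ n) ℕ.* (a ℕ.∸ n))           ≡⟨ pos-* (a ℕ.∸ n) (a ℕ.∸ n) ⟩
    + (a ℕ.∸ n) * + (a ℕ.∸ n)             ≡⟨ cong₂ _*_ a∸n≡ a∸n≡ ⟩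
    (x - + n) * (x - + n)                 ∎
    where
    open ≡-Reasoning
    a∸n≡ = trans (pos-∸ n≤a) (cong (_- + n) a≡x)

  isFloorPhi⇒isNormFloor : ∀ {n c} → IsFloorPhi n c → IsNormFloor (+ n) (+ c)
  isFloorPhi⇒isNormFloor {n} {c} fl@(lower , upper) =
      *-cancelˡ-≤-pos (norm (+ c) (+ n)) 0ℤ (+ 4)
        (subst (_≤ 0ℤ) (sym (four-norm (+ c) (+ n))) (i≤j⇒i-j≤0 (subst₂ _≤_ lower-cast five-n² (+≤+ lower))))
    , *-cancelˡ-<-nonNeg (+ 4)
        (subst (0ℤ <_) (sym (four-norm (1ℤ + + c) (+ n))) (<⇒0<- (subst₂ _<_ five-n² upper-cast (+<+ upper))))
    where
    n≤c = isFloorPhi⇒≤ fl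
    n≤2c = ℕ.≤-trans n≤c (ℕ.m≤n*m c 2)
    lower-cast : + ((2 ℕ.* c ℕ.∸ n) ℕ.^ 2) ≡ (+ 2 * + c - + n) * (+ 2 * + c - + n)
    lower-cast = pos-∸-square n≤2c (pos-* 2 c)
    upper-cast : + ((2 ℕ.* c ℕ.+ 2 ℕ.∸ n) ℕ.^ 2) ≡ (+ 2 * (1ℤ + + c) - + n) * (+ 2 * (1ℤ + + c) - + n)
    upper-cast = pos-∸-square (ℕ.≤-trans n≤2c (ℕ.m≤m+n (2 ℕ.* c) 2))
      (trans (pos-+ (2 ℕ.* c) 2) (trans (cong (_+ + 2) (pos-* 2 c)) (shift (+ c))))
      where
      shift : ∀ c → + 2 * c + + 2 ≡ + 2 * (1ℤ + c)
      shift = solve-∀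
    five-n² : + (5 ℕ.* n ℕ.^ 2) ≡ + 5 * (+ n * + n)
    five-n² = trans (pos-* 5 (n ℕ.^ 2))
      (cong (+ 5 *_) (trans (pos-∸-square {n} {0} z≤n refl) (cong₂ _*_ (+-identityʳ (+ n)) (+-identityʳ (+ n)))))
    four-norm : ∀ c n → + 4 * norm c n ≡ (+ 2 * c - n) * (+ 2 * c - n) - + 5 * (n * n)
    four-norm = solve-∀
    <⇒0<- : ∀ {x y} → x < y → 0ℤ < y - x
    <⇒0<- {x} {y} x<y = subst (_< y - x) (+-inverseʳ x) (+-monoˡ-< (- x) x<y)

  isNormFloor-unique : ∀ {n c c′} → 0ℤ ≤ n → 0ℤ ≤ c → 0ℤ ≤ c′ →
                       IsNormFloor n c → IsNormFloor n c′ → c ≡ c′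
  isNormFloor-unique 0≤n 0≤c 0≤c′ (Nc≤0 , 0<N[1+c]) (Nc′≤0 , 0<N[1+c′]) =
    ≤-antisym (<1+⇒≤ (norm-separates 0≤n (i≤j⇒i≤1+j 0≤c′) Nc≤0 0<N[1+c′]))
              (<1+⇒≤ (norm-separates 0≤n (i≤j⇒i≤1+j 0≤c) Nc′≤0 0<N[1+c]))
    where
    <1+⇒≤ : ∀ {x y} → x < 1ℤ + y → x ≤ y
    <1+⇒≤ {x} {y} x<1+y = subst (x ≤_) (pred-suc y) (i<j⇒i≤pred[j] x<1+y)

  isNormFloor-convergent⁻ : ∀ {p q} → norm p q ≡ -1ℤ → 1ℤ ≤ p → q ≤ p → IsNormFloor q p
  isNormFloor-convergent⁻ {p} {q} Npq≡-1 1≤p q≤p =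
      ≤-trans (≤-reflexive Npq≡-1) -≤+
    , suc[i]≤j⇒i<j (0≤i-j⇒j≤i (subst (0ℤ ≤_) (sym (identity p q))
        (+-nonneg (+-nonneg (≤-reflexive (sym (cong (_+ 1ℤ) Npq≡-1))) (i≤j⇒0≤j-i q≤p)) (i≤j⇒0≤j-i 1≤p))))
    where
    identity : ∀ p q → norm (1ℤ + p) q - 1ℤ ≡ (norm p q + 1ℤ) + (p - q) + (p - 1ℤ)
    identity = solve-∀

  isNormFloor-convergent⁺ : ∀ {p q} → norm p q ≡ 1ℤ → 0ℤ ≤ q → 1ℤ + q ≤ p → IsNormFloor q (p - 1ℤ)
  isNormFloor-convergent⁺ {p} {q} Npq≡1 0≤q 1+q≤p =
      0≤-⇒≤0 (subst (0ℤ ≤_) (sym (lower p q))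
        (+-nonneg (+-nonneg (i≤j⇒0≤j-i (≤-reflexive Npq≡1)) (i≤j⇒0≤j-i 1+q≤p))
                  (i≤j⇒0≤j-i (≤-trans (+-monoʳ-≤ 1ℤ 0≤q) 1+q≤p))))
    , subst (0ℤ <_) (sym (trans (cong (λ x → norm x q) (upper p)) Npq≡1)) (+<+ (s≤s z≤n))
    where
    lower : ∀ p q → - norm (p - 1ℤ) q ≡ (1ℤ - norm p q) + (p - (1ℤ + q)) + (p - 1ℤ)
    lower = solve-∀
    upper : ∀ p → 1ℤ + (p - 1ℤ) ≡ p
    upper = solve-∀

  isNormFloor-shift⁺ : ∀ {m c p q} → norm p q ≡ 1ℤ → 0ℤ < m → m ≤ q → 0ℤ ≤ c → 0ℤ ≤ p →
                       IsNormFloor m c → IsNormFloor (m + q) (c + p)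
  isNormFloor-shift⁺ {m} {c} {p} {q} Npq≡1 0<m m≤q 0≤c 0≤p (Ncm≤0 , 0<N[1+c]) =
      norm-+-≤0-convergent {c} {m} {p} {q} 0≤m m≤q Ncm≤-1 Npq≡1
    , subst (λ x → 0ℤ < norm x (m + q)) (+-assoc 1ℤ c p)
        (0≤norm⇒0<norm (+-nonneg 0≤1+c 0≤p) (+-mono-<-≤ 0<m 0≤q)
          (norm-+-≥0 {1ℤ + c} {m} {p} {q} 0≤1+c 0≤p (<⇒≤ 0<N[1+c]) (subst (0ℤ ≤_) (sym Npq≡1) (nonneg 1))))
    where
    0≤m = <⇒≤ 0<m
    0≤q = ≤-trans 0≤m m≤q
    0≤1+c = i≤j⇒i≤1+j 0≤c
    Ncm≤-1 : norm c m ≤ -1ℤ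
    Ncm≤-1 = i<j⇒i≤pred[j] (≤∧≢⇒< Ncm≤0 (norm≢0 0≤c 0<m))

  isNormFloor-shift⁻ : ∀ {m c p q} → norm p q ≡ -1ℤ → 0ℤ < m → m < q → 0ℤ ≤ c → 0ℤ ≤ p →
                       IsNormFloor m c → IsNormFloor (m + q) (c + p)
  isNormFloor-shift⁻ {m} {c} {p} {q} Npq≡-1 0<m m<q 0≤c 0≤p (Ncm≤0 , 0<N[1+c]) =
      norm-+-≤0 {c} {m} {p} {q} 0≤m 0≤q Ncm≤0 (≤-trans (≤-reflexive Npq≡-1) -≤+)
    , subst (λ x → 0ℤ < norm x (m + q)) (+-assoc 1ℤ c p)
        (0≤norm⇒0<norm (+-nonneg 0≤1+c 0≤p) (+-mono-<-≤ 0<m 0≤q)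
          (norm-+-≥0-convergent {1ℤ + c} {m} {p} {q} 0≤1+c (i<j⇒suc[i]≤j c<p) (i<j⇒suc[i]≤j 0<N[1+c]) Npq≡-1))
    where
    0≤m = <⇒≤ 0<m
    m≤q-1 : m ≤ -1ℤ + q
    m≤q-1 = i<j⇒i≤pred[j] m<q
    0≤q-1 = ≤-trans 0≤m m≤q-1
    0≤1+c = i≤j⇒i≤1+j 0≤c
    2≤q : + 2 ≤ q
    2≤q = ≤-trans (+-monoʳ-≤ 1ℤ (i<j⇒suc[i]≤j 0<m)) (i<j⇒suc[i]≤j m<q)
    0≤q = ≤-trans (nonneg 2) 2≤q
    -- c ≤ φm ≤ φ(q − 1) < p
    c<p : c < p
    c<p = norm-separates {c} {p} { -1ℤ + q} 0≤q-1 0≤p (norm-≤0-monoʳ {c} 0≤m m≤q-1 Ncm≤0)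
      (suc[i]≤j⇒i<j (0≤i-j⇒j≤i (subst (0ℤ ≤_) (sym (identity p q))
        (+-nonneg (+-nonneg (+-nonneg (subst (λ e → 0ℤ ≤ e + 1ℤ) (sym Npq≡-1) (nonneg 0)) 0≤p)
                            (*-nonneg (nonneg 2) (i≤j⇒0≤j-i 2≤q)))
                  (nonneg 1)))))
      where
      identity : ∀ p q → norm p (-1ℤ + q) - 1ℤ ≡ (norm p q + 1ℤ) + p + + 2 * (q - + 2) + 1ℤ
      identity = solve-∀

module FiniteSums where
  open import Data.Nat as ℕ using (ℕ; zero; suc; z≤n; s≤s)
  import Data.Nat.Properties as ℕ
  open import Data.Integer using (ℤ; +_; 0ℤ; 1ℤ; _+_; _*_; _^_)
  open import Data.Integer.Properties using (+-assoc; +-identityʳ; pos-+)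
  open import Data.Integer.Tactic.RingSolver using (solve-∀)
  open ≡-Reasoning

  sumFrom1-cong : ∀ {u v} N → (∀ n → 1 ℕ.≤ n → n ℕ.≤ N → u n ≡ v n) → sumFrom1 u N ≡ sumFrom1 v N
  sumFrom1-cong zero    _   = refl
  sumFrom1-cong (suc N) u≗v =
    cong₂ _+_ (sumFrom1-cong N (λ n 1≤n n≤N → u≗v n 1≤n (ℕ.m≤n⇒m≤1+n n≤N)))
              (u≗v (suc N) (s≤s z≤n) ℕ.≤-refl)

  sumFrom1-last : ∀ u {N} → 1 ℕ.≤ N → sumFrom1 u N ≡ sumFrom1 u (N ℕ.∸ 1) + u N
  sumFrom1-last u {suc N} _ = refl

  sumFrom1-+ : ∀ u M N → sumFrom1 u (M ℕ.+ N) ≡ sumFrom1 u M + sumFrom1 (λ n → u (M ℕ.+ n)) N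
  sumFrom1-+ u M zero    = trans (cong (sumFrom1 u) (ℕ.+-identityʳ M)) (sym (+-identityʳ _))
  sumFrom1-+ u M (suc N) = begin
    sumFrom1 u (M ℕ.+ suc N)                                        ≡⟨ cong (sumFrom1 u) (ℕ.+-suc M N) ⟩
    sumFrom1 u (M ℕ.+ N) + u (suc (M ℕ.+ N))                        ≡⟨ cong (_+ u (suc (M ℕ.+ N))) (sumFrom1-+ u M N) ⟩
    sumFrom1 u M + sumFrom1 (λ n → u (M ℕ.+ n)) N + u (suc (M ℕ.+ N))
                                                  ≡⟨ +-assoc (sumFrom1 u M) _ _ ⟩
    sumFrom1 u M + (sumFrom1 (λ n → u (M ℕ.+ n)) N + u (suc (M ℕ.+ N)))
                                                  ≡⟨ cong (λ k → sumFrom1 u M + (sumFrom1 (λ n → u (M ℕ.+ n)) N + u k)) (ℕ.+-suc M N) ⟨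
    sumFrom1 u M + sumFrom1 (λ n → u (M ℕ.+ n)) (suc N)            ∎

  moment : (ℕ → ℤ) → ℕ → ℕ → ℤ
  moment u p N = sumFrom1 (λ n → u n ^ p) N

  moment-zero : ∀ u N → moment u 0 N ≡ + N
  moment-zero u zero    = refl
  moment-zero u (suc N) = trans (cong (_+ 1ℤ) (moment-zero u N)) (trans (sym (pos-+ N 1)) (cong +_ (ℕ.+-comm N 1)))

  moment-shift₁ : ∀ u K N → moment (λ n → u n + K) 1 N ≡ moment u 1 N + K * moment u 0 N
  moment-shift₁ u K zero    = base K
    where
    base : ∀ K → 0ℤ ≡ 0ℤ + K * 0ℤ
    base = solve-∀
  moment-shift₁ u K (suc N) =
    trans (cong (_+ (u (suc N) + K) ^ 1) (moment-shift₁ u K N)) (step (moment u 1 N) (moment u 0 N) (u (suc N)) K)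
    where
    step : ∀ m₁ m₀ x K → m₁ + K * m₀ + (x + K) * 1ℤ ≡ m₁ + x * 1ℤ + K * (m₀ + 1ℤ)
    step = solve-∀

  moment-shift₂ : ∀ u K N → moment (λ n → u n + K) 2 N
                              ≡ moment u 2 N + + 2 * K * moment u 1 N + K * K * moment u 0 N
  moment-shift₂ u K zero    = base K
    where
    base : ∀ K → 0ℤ ≡ 0ℤ + + 2 * K * 0ℤ + K * K * 0ℤ
    base = solve-∀
  moment-shift₂ u K (suc N) = trans (cong (_+ (u (suc N) + K) ^ 2) (moment-shift₂ u K N))
                                    (step (moment u 2 N) (moment u 1 N) (moment u 0 N) (u (suc N)) K)
    where
    step : ∀ m₂ m₁ m₀ x K → m₂ + + 2 * K * m₁ + K * K * m₀ + (x + K) * ((x + K) * 1ℤ)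
                            ≡ m₂ + x * (x * 1ℤ) + + 2 * K * (m₁ + x * 1ℤ) + K * K * (m₀ + 1ℤ)
    step = solve-∀

  moment-shift₃ : ∀ u K N → moment (λ n → u n + K) 3 N
                              ≡ moment u 3 N + + 3 * K * moment u 2 N + + 3 * K * K * moment u 1 N + K * K * K * moment u 0 N
  moment-shift₃ u K zero    = base K
    where
    base : ∀ K → 0ℤ ≡ 0ℤ + + 3 * K * 0ℤ + + 3 * K * K * 0ℤ + K * K * K * 0ℤ
    base = solve-∀
  moment-shift₃ u K (suc N) = trans (cong (_+ (u (suc N) + K) ^ 3) (moment-shift₃ u K N))
                                    (step (moment u 3 N) (moment u 2 N) (moment u 1 N) (moment u 0 N) (u (suc N)) K)
    where
    step : ∀ m₃ m₂ m₁ m₀ x K →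
           m₃ + + 3 * K * m₂ + + 3 * K * K * m₁ + K * K * K * m₀ + (x + K) * ((x + K) * ((x + K) * 1ℤ))
           ≡ m₃ + x * (x * (x * 1ℤ)) + + 3 * K * (m₂ + x * (x * 1ℤ)) + + 3 * K * K * (m₁ + x * 1ℤ)
             + K * K * K * (m₀ + 1ℤ)
    step = solve-∀

module ClosedForms where
  open import Data.Integer using (ℤ; +_; 0ℤ; 1ℤ; -1ℤ; _+_; _-_; _*_; -_)
  open import Data.Integer.Tactic.RingSolver using (solve-∀)
  open NormForm using (norm)

  -- For a = F k, b = F (k + 1) and h = k mod 2 these are 2 Σ f, 6 Σ f² and 4 Σ f³ over 0 < n < F k;
  -- the coefficient of 1 − h is the even case, that of h the odd case.
  Φ₁ : ℤ → ℤ → ℤ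
  Φ₁ a b = (a - 1ℤ) * (b - 1ℤ)
  {-# INLINE Φ₁ #-}

  Φ₂ : ℤ → ℤ → ℤ → ℤ
  Φ₂ a b h = (1ℤ - h) * ((b - a - 1ℤ) * (b - 1ℤ) * (+ 2 * b + + 2 * a - 1ℤ))
           + h * ((a - 1ℤ) * (+ 2 * a * a + + 2 * a * b - a - + 4 * b))
  {-# INLINE Φ₂ #-}

  Φ₃ : ℤ → ℤ → ℤ → ℤ
  Φ₃ a b h = (1ℤ - h) * ((b - a - 1ℤ) * (b - 1ℤ) * (b - 1ℤ) * (b + a - 1ℤ))
           + h * ((a - 1ℤ) * (b - 1ℤ) * (a * a + a * b - a - + 2 * b))
  {-# INLINE Φ₃ #-}

  modulo : ∀ {x y u r} → u ≡ 0ℤ → x ≡ y + u * r → x ≡ y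
  modulo {y = y} {r = r} refl x≡ = trans x≡ (identity y r)
    where
    identity : ∀ y r → y + 0ℤ * r ≡ y
    identity = solve-∀

  -- The identities below hold modulo h² = h and Cassini's N(b, a) = 1 − 2h; the multipliers
  -- of the two relations were found by polynomial division.
  closed-form-step₁ : ∀ {a b h K K′ t₁ s₁ s₀} → h * h - h ≡ 0ℤ → norm b a - (1ℤ - + 2 * h) ≡ 0ℤ →
                      K ≡ b + a → K′ ≡ K + b → s₀ ≡ a - 1ℤ → t₁ ≡ Φ₁ b K → s₁ ≡ Φ₁ a b →
                      t₁ + + 2 * (K - h) + s₁ + + 2 * K * s₀ ≡ Φ₁ K K′
  closed-form-step₁ {a} {b} {h} h²≡h cassini refl refl refl refl refl =
    modulo h²≡h (modulo cassini (identity a b h))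
    where
    identity : ∀ a b h → Φ₁ b (b + a) + + 2 * (b + a - h) + Φ₁ a b + + 2 * (b + a) * (a - 1ℤ)
                         ≡ Φ₁ (b + a) (b + a + b) + (h * h - h) * 0ℤ + (norm b a - (1ℤ - + 2 * h)) * -1ℤ
    identity = solve-∀

  closed-form-step₂ : ∀ {a b h K K′ t₂ s₂ s₁ s₀} → h * h - h ≡ 0ℤ → norm b a - (1ℤ - + 2 * h) ≡ 0ℤ →
                      K ≡ b + a → K′ ≡ K + b → s₀ ≡ a - 1ℤ →
                      t₂ ≡ Φ₂ b K (1ℤ - h) → s₂ ≡ Φ₂ a b h → s₁ ≡ Φ₁ a b →
                      t₂ + + 6 * ((K - h) * (K - h)) + s₂ + + 6 * K * s₁ + + 6 * (K * K) * s₀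
                        ≡ Φ₂ K K′ (1ℤ - (1ℤ - h))
  closed-form-step₂ {a} {b} {h} h²≡h cassini refl refl refl refl refl refl =
    modulo h²≡h (modulo cassini (identity a b h))
    where
    identity : ∀ a b h →
      Φ₂ b (b + a) (1ℤ - h) + + 6 * ((b + a - h) * (b + a - h)) + Φ₂ a b h
        + + 6 * (b + a) * Φ₁ a b + + 6 * ((b + a) * (b + a)) * (a - 1ℤ)
      ≡ Φ₂ (b + a) (b + a + b) (1ℤ - (1ℤ - h))
        + (h * h - h) * - + 4 + (norm b a - (1ℤ - + 2 * h)) * (- + 6 * a - + 6 * b + + 5 * h)
    identity = solve-∀

  closed-form-step₃ : ∀ {a b h K K′ t₃ s₃ s₂ s₁ s₀} → h * h - h ≡ 0ℤ → norm b a - (1ℤ - + 2 * h) ≡ 0ℤ →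
                      K ≡ b + a → K′ ≡ K + b → s₀ ≡ a - 1ℤ →
                      t₃ ≡ Φ₃ b K (1ℤ - h) → s₃ ≡ Φ₃ a b h → s₂ ≡ Φ₂ a b h → s₁ ≡ Φ₁ a b →
                      t₃ + + 4 * ((K - h) * (K - h) * (K - h)) + s₃ + + 2 * K * s₂
                        + + 6 * (K * K) * s₁ + + 4 * (K * K * K) * s₀
                        ≡ Φ₃ K K′ (1ℤ - (1ℤ - h))
  closed-form-step₃ {a} {b} {h} h²≡h cassini refl refl refl refl refl refl refl =
    modulo h²≡h (modulo cassini (identity a b h))
    where
    identity : ∀ a b h →
      Φ₃ b (b + a) (1ℤ - h) + + 4 * ((b + a - h) * (b + a - h) * (b + a - h)) + Φ₃ a b h
        + + 2 * (b + a) * Φ₂ a b h + + 6 * ((b + a) * (b + a)) * Φ₁ a b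
        + + 4 * ((b + a) * (b + a) * (b + a)) * (a - 1ℤ)
      ≡ Φ₃ (b + a) (b + a + b) (1ℤ - (1ℤ - h))
        + (h * h - h) * (+ 6 * a * a + + 10 * a * b - + 8 * a + + 2 * b * b - + 8 * b - + 4 * h + + 2)
        + (norm b a - (1ℤ - + 2 * h))
          * (- + 3 * a * a * h - + 4 * a * a - + 5 * a * b * h - + 8 * a * b + + 10 * a * h
             - b * b * h - + 5 * b * b + + 10 * b * h + b - + 3 * h)
    identity = solve-∀

  even-closed-form : ∀ {a b c K} → b ≡ a + c → K ≡ b + a →
                     Φ₃ a b 0ℤ ≡ (c - + 1) * (b - + 1) * (b - + 1) * (K - + 1)
  even-closed-form {a} {c = c} refl refl = identity a c
    where
    identity : ∀ a c → Φ₃ a (a + c) 0ℤ ≡ (c - + 1) * (a + c - + 1) * (a + c - + 1) * (a + c + a - + 1)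
    identity = solve-∀

  -- D and D′ are F (2n + 3) and F (2n + 2), the L's are Lucas numbers, for a = F n, b = F (n + 1).
  odd-closed-form : ∀ {a b K K′ D D′ L₀ L₁ L₂} → norm b a ≡ -1ℤ → K ≡ b + a → K′ ≡ K + b →
                    D ≡ K * K + b * b → D′ ≡ b * K + a * b →
                    L₂ ≡ + 2 * D - D′ → L₁ ≡ + 2 * K′ - K → L₀ ≡ + 2 * K - b →
                    + 5 * Φ₃ a b 1ℤ ≡ (a - + 1) * (b - + 1) * (L₂ - + 3 * L₁ - L₀ + + 3)
  odd-closed-form {a} {b} cassini refl refl refl refl refl refl refl =
    sym (modulo (cong (_+ 1ℤ) cassini) (identity a b))
    where
    identity : ∀ a b →
      (a - + 1) * (b - + 1)
        * (+ 2 * ((b + a) * (b + a) + b * b) - (b * (b + a) + a * b)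
           - + 3 * (+ 2 * (b + a + b) - (b + a)) - (+ 2 * (b + a) - b) + + 3)
      ≡ + 5 * Φ₃ a b 1ℤ + (norm b a + 1ℤ) * (+ 3 * (a - + 1) * (b - + 1))
    identity = solve-∀

module FloorSums (f : ℕ → ℕ) (f-floor : ∀ n → IsFloorPhi n (f n)) where
  open import Data.Nat as ℕ using (ℕ; zero; suc; z≤n; s≤s)
  import Data.Nat.Properties as ℕ
  import Data.Nat.Tactic.RingSolver as ℕ-Solver
  open import Data.Integer using (ℤ; +_; 0ℤ; 1ℤ; -1ℤ; _+_; _-_; _*_; _^_; _≤_; +≤+; +<+)
  open import Data.Integer.Properties using (pos-+; +-comm; +-identityʳ; +-inverseʳ; i≤j⇒0≤j-i)
  open import Data.Integer.Tactic.RingSolver using (solve-∀)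
  open Casts
  open NormForm using (norm; nonneg; +-nonneg)
  open Fibonacci
  open GoldenFloor
  open FiniteSums
  open ClosedForms
  open ≡-Reasoning

  f-isNormFloor : ∀ n → IsNormFloor (+ n) (+ f n)
  f-isNormFloor n = isFloorPhi⇒isNormFloor {n} {f n} (f-floor n)

  f-unique : ∀ {n c} → 0ℤ ≤ c → IsNormFloor (+ n) c → + f n ≡ c
  f-unique {n} 0≤c = isNormFloor-unique (nonneg n) (nonneg (f n)) 0≤c (f-isNormFloor n)

  f-fib : ∀ k → 1 ℕ.≤ k → + f (fib (suc k)) ≡ Fz (suc (suc k)) - parity k
  f-fib k@(suc k′) _ with parity-cases k
  ... | inj₁ h≡0 = begin
    + f (fib (suc k))           ≡⟨ f-unique (nonneg (fib (suc (suc k))))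
                                     (isNormFloor-convergent⁻ N≡-1 (+≤+ (1≤fib[1+n] (suc k))) (+≤+ (fib-mono (suc k)))) ⟩
    Fz (suc (suc k))            ≡⟨ +-identityʳ _ ⟨
    Fz (suc (suc k)) - 0ℤ       ≡⟨ cong (λ h → Fz (suc (suc k)) - h) h≡0 ⟨
    Fz (suc (suc k)) - parity k ∎
    where
    N≡-1 : norm (Fz (suc (suc k))) (Fz (suc k)) ≡ -1ℤ
    N≡-1 = trans (cassini (suc k)) (cong (λ h → 1ℤ - + 2 * (1ℤ - h)) h≡0)
  ... | inj₂ h≡1 = begin
    + f (fib (suc k))           ≡⟨ f-unique (i≤j⇒0≤j-i (+≤+ (1≤fib[1+n] (suc k))))
                                            (isNormFloor-convergent⁺ N≡1 (nonneg (fib (suc k)))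
                                              (+≤+ (ℕ.m<m+n _ (1≤fib[1+n] k′)))) ⟩
    Fz (suc (suc k)) - 1ℤ       ≡⟨ cong (λ h → Fz (suc (suc k)) - h) h≡1 ⟨
    Fz (suc (suc k)) - parity k ∎
    where
    N≡1 : norm (Fz (suc (suc k))) (Fz (suc k)) ≡ 1ℤ
    N≡1 = trans (cassini (suc k)) (cong (λ h → 1ℤ - + 2 * (1ℤ - h)) h≡1)

  f-shift : ∀ j m → 1 ℕ.≤ m → m ℕ.< fib j → + f (fib j ℕ.+ m) ≡ + f m + Fz (suc j)
  f-shift j m 1≤m m<F =
    f-unique (+-nonneg (nonneg (f m)) (nonneg (fib (suc j)))) (subst (λ n → IsNormFloor n (+ f m + Fz (suc j))) m+F≡ shifted)
    where
    m+F≡ : + m + Fz j ≡ + (fib j ℕ.+ m)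
    m+F≡ = trans (+-comm (+ m) (Fz j)) (sym (pos-+ (fib j) m))
    shifted : IsNormFloor (+ m + Fz j) (+ f m + Fz (suc j))
    shifted with parity-cases j
    ... | inj₁ h≡0 = isNormFloor-shift⁺ (trans (cassini j) (cong (λ h → 1ℤ - + 2 * h) h≡0))
                       (+<+ 1≤m) (+≤+ (ℕ.<⇒≤ m<F)) (nonneg (f m)) (nonneg (fib (suc j))) (f-isNormFloor m)
    ... | inj₂ h≡1 = isNormFloor-shift⁻ (trans (cassini j) (cong (λ h → 1ℤ - + 2 * h) h≡1))
                       (+<+ 1≤m) (+<+ m<F) (nonneg (f m)) (nonneg (fib (suc j))) (f-isNormFloor m)

  S : ℕ → ℕ → ℤ
  S p k = moment (λ n → + f n) p (fib k ℕ.∸ 1)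

  S-zero : ∀ k → 1 ℕ.≤ k → S 0 k ≡ Fz k - 1ℤ
  S-zero (suc k) _ = trans (moment-zero (λ n → + f n) (fib (suc k) ℕ.∸ 1)) (pos-∸ (1≤fib[1+n] k))

  -- Split 0 < n < F (k + 2) at n = F (k + 1) and shift the upper part down by F (k + 1).
  S-rec : ∀ p k → 1 ℕ.≤ k →
          S p (suc (suc k)) ≡ S p (suc k) + (Fz (suc (suc k)) - parity k) ^ p
                              + moment (λ m → + f m + Fz (suc (suc k))) p (fib k ℕ.∸ 1)
  S-rec p k@(suc k′) 1≤k = begin
    S p (suc (suc k))
      ≡⟨ cong (moment u p) (ℕ.+-∸-assoc (fib (suc k)) (1≤fib[1+n] k′)) ⟩
    moment u p (fib (suc k) ℕ.+ (fib k ℕ.∸ 1))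
      ≡⟨ sumFrom1-+ (λ n → u n ^ p) (fib (suc k)) (fib k ℕ.∸ 1) ⟩
    moment u p (fib (suc k)) + sumFrom1 (λ m → u (fib (suc k) ℕ.+ m) ^ p) (fib k ℕ.∸ 1)
      ≡⟨ cong₂ _+_ (sumFrom1-last (λ n → u n ^ p) (1≤fib[1+n] k)) (sumFrom1-cong (fib k ℕ.∸ 1) shift) ⟩
    S p (suc k) + u (fib (suc k)) ^ p + moment (λ m → u m + Fz (suc (suc k))) p (fib k ℕ.∸ 1)
      ≡⟨ cong (λ g → S p (suc k) + g ^ p + moment (λ m → u m + Fz (suc (suc k))) p (fib k ℕ.∸ 1))
              (f-fib k 1≤k) ⟩
    S p (suc k) + (Fz (suc (suc k)) - parity k) ^ p + moment (λ m → u m + Fz (suc (suc k))) p (fib k ℕ.∸ 1) ∎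
    where
    u : ℕ → ℤ
    u n = + f n
    ≤∸1⇒< : ∀ {m N} → 1 ℕ.≤ N → m ℕ.≤ N ℕ.∸ 1 → m ℕ.< N
    ≤∸1⇒< {N = suc N} _ m≤N = s≤s m≤N
    shift : ∀ m → 1 ℕ.≤ m → m ℕ.≤ fib k ℕ.∸ 1 → u (fib (suc k) ℕ.+ m) ^ p ≡ (u m + Fz (suc (suc k))) ^ p
    shift m 1≤m m≤ =
      cong (_^ p) (f-shift (suc k) m 1≤m (ℕ.<-≤-trans (≤∸1⇒< (1≤fib[1+n] k′) m≤) (fib-mono k)))

  S-rec₁ : ∀ k → 1 ℕ.≤ k →
           + 2 * S 1 (suc (suc k))
           ≡ + 2 * S 1 (suc k) + + 2 * (Fz (suc (suc k)) - parity k) + + 2 * S 1 k + + 2 * Fz (suc (suc k)) * S 0 k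
  S-rec₁ k 1≤k = begin
    + 2 * S 1 (suc (suc k))                                ≡⟨ cong (+ 2 *_) (S-rec 1 k 1≤k) ⟩
    + 2 * (S 1 (suc k) + g ^ 1 + moment (λ m → + f m + K) 1 (fib k ℕ.∸ 1))
                                                           ≡⟨ cong (λ x → + 2 * (S 1 (suc k) + g ^ 1 + x))
                                                                   (moment-shift₁ (λ m → + f m) K (fib k ℕ.∸ 1)) ⟩
    + 2 * (S 1 (suc k) + g ^ 1 + (S 1 k + K * S 0 k))      ≡⟨ expand (S 1 (suc k)) g (S 1 k) (S 0 k) K ⟩
    + 2 * S 1 (suc k) + + 2 * g + + 2 * S 1 k + + 2 * K * S 0 k ∎
    where
    K = Fz (suc (suc k))
    g = K - parity k
    expand : ∀ t g s₁ s₀ K → + 2 * (t + g * 1ℤ + (s₁ + K * s₀)) ≡ + 2 * t + + 2 * g + + 2 * s₁ + + 2 * K * s₀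
    expand = solve-∀

  S-rec₂ : ∀ k → 1 ℕ.≤ k →
           + 6 * S 2 (suc (suc k))
           ≡ + 6 * S 2 (suc k) + + 6 * ((Fz (suc (suc k)) - parity k) * (Fz (suc (suc k)) - parity k))
             + + 6 * S 2 k + + 6 * Fz (suc (suc k)) * (+ 2 * S 1 k)
             + + 6 * (Fz (suc (suc k)) * Fz (suc (suc k))) * S 0 k
  S-rec₂ k 1≤k = begin
    + 6 * S 2 (suc (suc k))                                ≡⟨ cong (+ 6 *_) (S-rec 2 k 1≤k) ⟩
    + 6 * (S 2 (suc k) + g ^ 2 + moment (λ m → + f m + K) 2 (fib k ℕ.∸ 1))
                                                           ≡⟨ cong (λ x → + 6 * (S 2 (suc k) + g ^ 2 + x))
                                                                   (moment-shift₂ (λ m → + f m) K (fib k ℕ.∸ 1)) ⟩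
    + 6 * (S 2 (suc k) + g ^ 2 + (S 2 k + + 2 * K * S 1 k + K * K * S 0 k))
                                                           ≡⟨ expand (S 2 (suc k)) g (S 2 k) (S 1 k) (S 0 k) K ⟩
    + 6 * S 2 (suc k) + + 6 * (g * g) + + 6 * S 2 k + + 6 * K * (+ 2 * S 1 k) + + 6 * (K * K) * S 0 k ∎
    where
    K = Fz (suc (suc k))
    g = K - parity k
    expand : ∀ t g s₂ s₁ s₀ K →
             + 6 * (t + g * (g * 1ℤ) + (s₂ + + 2 * K * s₁ + K * K * s₀))
             ≡ + 6 * t + + 6 * (g * g) + + 6 * s₂ + + 6 * K * (+ 2 * s₁) + + 6 * (K * K) * s₀
    expand = solve-∀

  S-rec₃ : ∀ k → 1 ℕ.≤ k →
           + 4 * S 3 (suc (suc k))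
           ≡ + 4 * S 3 (suc k)
             + + 4 * ((Fz (suc (suc k)) - parity k) * (Fz (suc (suc k)) - parity k) * (Fz (suc (suc k)) - parity k))
             + + 4 * S 3 k + + 2 * Fz (suc (suc k)) * (+ 6 * S 2 k)
             + + 6 * (Fz (suc (suc k)) * Fz (suc (suc k))) * (+ 2 * S 1 k)
             + + 4 * (Fz (suc (suc k)) * Fz (suc (suc k)) * Fz (suc (suc k))) * S 0 k
  S-rec₃ k 1≤k = begin
    + 4 * S 3 (suc (suc k))                                ≡⟨ cong (+ 4 *_) (S-rec 3 k 1≤k) ⟩
    + 4 * (S 3 (suc k) + g ^ 3 + moment (λ m → + f m + K) 3 (fib k ℕ.∸ 1))
                                                           ≡⟨ cong (λ x → + 4 * (S 3 (suc k) + g ^ 3 + x))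
                                                                   (moment-shift₃ (λ m → + f m) K (fib k ℕ.∸ 1)) ⟩
    + 4 * (S 3 (suc k) + g ^ 3 + (S 3 k + + 3 * K * S 2 k + + 3 * K * K * S 1 k + K * K * K * S 0 k))
                                                           ≡⟨ expand (S 3 (suc k)) g (S 3 k) (S 2 k) (S 1 k) (S 0 k) K ⟩
    + 4 * S 3 (suc k) + + 4 * (g * g * g) + + 4 * S 3 k + + 2 * K * (+ 6 * S 2 k)
      + + 6 * (K * K) * (+ 2 * S 1 k) + + 4 * (K * K * K) * S 0 k ∎
    where
    K = Fz (suc (suc k))
    g = K - parity k
    expand : ∀ t g s₃ s₂ s₁ s₀ K →
             + 4 * (t + g * (g * (g * 1ℤ)) + (s₃ + + 3 * K * s₂ + + 3 * K * K * s₁ + K * K * K * s₀))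
             ≡ + 4 * t + + 4 * (g * g * g) + + 4 * s₃ + + 2 * K * (+ 6 * s₂)
               + + 6 * (K * K) * (+ 2 * s₁) + + 4 * (K * K * K) * s₀
    expand = solve-∀

  HasClosedForms : ℕ → Set
  HasClosedForms k = + 2 * S 1 k ≡ Φ₁ (Fz k) (Fz (suc k))
                   × + 6 * S 2 k ≡ Φ₂ (Fz k) (Fz (suc k)) (parity k)
                   × + 4 * S 3 k ≡ Φ₃ (Fz k) (Fz (suc k)) (parity k)

  hasClosedForms-step : ∀ k → 1 ℕ.≤ k → HasClosedForms k → HasClosedForms (suc k) → HasClosedForms (suc (suc k))
  hasClosedForms-step k 1≤k (e₁ , e₂ , e₃) (e₁′ , e₂′ , e₃′) =
      trans (S-rec₁ k 1≤k) (closed-form-step₁ {Fz k} {Fz (suc k)} {parity k} h²≡h cas K≡ K′≡ s₀≡ e₁′ e₁)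
    , trans (S-rec₂ k 1≤k) (closed-form-step₂ {Fz k} {Fz (suc k)} {parity k} h²≡h cas K≡ K′≡ s₀≡ e₂′ e₂ e₁)
    , trans (S-rec₃ k 1≤k) (closed-form-step₃ {Fz k} {Fz (suc k)} {parity k} h²≡h cas K≡ K′≡ s₀≡ e₃′ e₃ e₂ e₁)
    where
    K≡ = Fz-rec k
    K′≡ = Fz-rec (suc k)
    s₀≡ = S-zero k 1≤k
    h²≡h = parity-idem k
    cas : norm (Fz (suc k)) (Fz k) - (1ℤ - + 2 * parity k) ≡ 0ℤ
    cas = trans (cong (_- (1ℤ - + 2 * parity k)) (cassini k)) (+-inverseʳ (1ℤ - + 2 * parity k))

  hasClosedForms : ∀ k → 1 ℕ.≤ k → HasClosedForms k
  hasClosedForms (suc k) _ = proj₁ (pair k)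
    where
    pair : ∀ k → HasClosedForms (suc k) × HasClosedForms (suc (suc k))
    -- F 1 = F 2 = 1: both sums are empty and all closed forms vanish.
    pair zero    = (refl , refl , refl) , (refl , refl , refl)
    pair (suc k) = proj₂ (pair k) , hasClosedForms-step (suc k) (s≤s z≤n) (proj₁ (pair k)) (proj₂ (pair k))

  S₃-even : ∀ m → 1 ℕ.≤ m → parity m ≡ 0ℤ →
            + 4 * S 3 m ≡ (Fz (m ℕ.∸ 1) - + 1) * (Fz (suc m) - + 1) * (Fz (suc m) - + 1) * (Fz (suc (suc m)) - + 1)
  S₃-even m@(suc n) 1≤m h≡0 = begin
    + 4 * S 3 m                         ≡⟨ proj₂ (proj₂ (hasClosedForms m 1≤m)) ⟩
    Φ₃ (Fz m) (Fz (suc m)) (parity m)   ≡⟨ cong (Φ₃ (Fz m) (Fz (suc m))) h≡0 ⟩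
    Φ₃ (Fz m) (Fz (suc m)) 0ℤ           ≡⟨ even-closed-form {Fz m} {Fz (suc m)} {Fz n} (Fz-rec n) (Fz-rec m) ⟩
    (Fz n - + 1) * (Fz (suc m) - + 1) * (Fz (suc m) - + 1) * (Fz (suc (suc m)) - + 1) ∎

  -- Indexed by the even successor m = n + 1 of the odd index n.
  S₃-odd : ∀ m → 1 ℕ.≤ m → parity m ≡ 0ℤ →
           + 20 * S 3 (m ℕ.∸ 1) ≡ (Fz (m ℕ.∸ 1) - + 1) * (Fz m - + 1) * (Lz (m ℕ.+ m) - + 3 * Lz (suc m) - Lz m + + 3)
  S₃-odd (suc zero)        _ ()
  S₃-odd m@(suc n@(suc _)) _ h′≡0 = begin
    + 20 * S 3 n                        ≡⟨ twenty (S 3 n) ⟩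
    + 5 * (+ 4 * S 3 n)                 ≡⟨ cong (+ 5 *_) (proj₂ (proj₂ (hasClosedForms n (s≤s z≤n)))) ⟩
    + 5 * Φ₃ (Fz n) (Fz m) (parity n)   ≡⟨ cong (λ h → + 5 * Φ₃ (Fz n) (Fz m) h) h≡1 ⟩
    + 5 * Φ₃ (Fz n) (Fz m) 1ℤ           ≡⟨ odd-closed-form (trans (cassini n) (cong (λ h → 1ℤ - + 2 * h) h≡1))
                                             (Fz-rec n) (Fz-rec m) (Fz-+ m m) (Fz-+ n m)
                                             (Lz≡2Fz-Fz (m ℕ.+ m)) (Lz≡2Fz-Fz (suc m)) (Lz≡2Fz-Fz m) ⟩
    (Fz n - + 1) * (Fz m - + 1) * (Lz (m ℕ.+ m) - + 3 * Lz (suc m) - Lz m + + 3) ∎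
    where
    h≡1 = parity-pred n h′≡0
    twenty : ∀ x → + 20 * x ≡ + 5 * (+ 4 * x)
    twenty = solve-∀

  A3≡S₃ : ∀ k → A3 f k ≡ S 3 k
  A3≡S₃ k = sumFrom1-cong (fib k ℕ.∸ 1) (λ n _ _ → pos-^ (f n) 3)

  A3-even : ∀ k → 1 ℕ.≤ k →
            + 4 * A3 f (2 ℕ.* k)
            ≡ (Fz (2 ℕ.* k ℕ.∸ 1) - + 1) * (Fz (2 ℕ.* k ℕ.+ 1) - + 1) * (Fz (2 ℕ.* k ℕ.+ 1) - + 1)
              * (Fz (2 ℕ.* k ℕ.+ 2) - + 1)
  A3-even k 1≤k = begin
    + 4 * A3 f m                        ≡⟨ cong (+ 4 *_) (A3≡S₃ m) ⟩
    + 4 * S 3 m                         ≡⟨ S₃-even m (ℕ.≤-trans 1≤k (ℕ.m≤n*m k 2)) (parity-2* k) ⟩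
    (Fz (m ℕ.∸ 1) - + 1) * (Fz (suc m) - + 1) * (Fz (suc m) - + 1) * (Fz (suc (suc m)) - + 1)
                                        ≡⟨ cong₂ (λ i j → (Fz (m ℕ.∸ 1) - + 1) * (Fz i - + 1) * (Fz i - + 1) * (Fz j - + 1))
                                                 (ℕ.+-comm m 1) (ℕ.+-comm m 2) ⟨
    (Fz (m ℕ.∸ 1) - + 1) * (Fz (m ℕ.+ 1) - + 1) * (Fz (m ℕ.+ 1) - + 1) * (Fz (m ℕ.+ 2) - + 1) ∎
    where
    m = 2 ℕ.* k

  A3-odd : ∀ k → 1 ℕ.≤ k →
           + 20 * A3 f (2 ℕ.* k ℕ.∸ 1)
           ≡ (Fz (2 ℕ.* k ℕ.∸ 1) - + 1) * (Fz (2 ℕ.* k) - + 1)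
             * (Lz (4 ℕ.* k) - + 3 * Lz (2 ℕ.* k ℕ.+ 1) - Lz (2 ℕ.* k) + + 3)
  A3-odd k 1≤k = begin
    + 20 * A3 f (m ℕ.∸ 1)               ≡⟨ cong (+ 20 *_) (A3≡S₃ (m ℕ.∸ 1)) ⟩
    + 20 * S 3 (m ℕ.∸ 1)                ≡⟨ S₃-odd m (ℕ.≤-trans 1≤k (ℕ.m≤n*m k 2)) (parity-2* k) ⟩
    (Fz (m ℕ.∸ 1) - + 1) * (Fz m - + 1) * (Lz (m ℕ.+ m) - + 3 * Lz (suc m) - Lz m + + 3)
                                        ≡⟨ cong₂ (λ i j → (Fz (m ℕ.∸ 1) - + 1) * (Fz m - + 1) * (Lz i - + 3 * Lz j - Lz m + + 3))
                                                 (four-k k) (ℕ.+-comm m 1) ⟨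
    (Fz (m ℕ.∸ 1) - + 1) * (Fz m - + 1) * (Lz (4 ℕ.* k) - + 3 * Lz (m ℕ.+ 1) - Lz m + + 3) ∎
    where
    m = 2 ℕ.* k
    four-k : ∀ k → 4 ℕ.* k ≡ 2 ℕ.* k ℕ.+ 2 ℕ.* k
    four-k = ℕ-Solver.solve-∀

open import Data.Nat using (_*_; _+_; _∸_; _≤_)
import Data.Integer as ℤ

lemma3 : (f : ℕ → ℕ) → (∀ n → IsFloorPhi n (f n)) →
    (k : ℕ) → 1 ≤ k →
      (ℤ.+ 4 ℤ.* A3 f (2 * k)
        ≡ (Fz (2 * k ∸ 1) ℤ.- ℤ.+ 1) ℤ.* (Fz (2 * k + 1) ℤ.- ℤ.+ 1) ℤ.* (Fz (2 * k + 1) ℤ.- ℤ.+ 1)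
          ℤ.* (Fz (2 * k + 2) ℤ.- ℤ.+ 1))
      ×
      (ℤ.+ 20 ℤ.* A3 f (2 * k ∸ 1)
        ≡ (Fz (2 * k ∸ 1) ℤ.- ℤ.+ 1) ℤ.* (Fz (2 * k) ℤ.- ℤ.+ 1)
          ℤ.* (Lz (4 * k) ℤ.- ℤ.+ 3 ℤ.* Lz (2 * k + 1) ℤ.- Lz (2 * k) ℤ.+ ℤ.+ 3))
lemma3 f f-floor k 1≤k = A3-even k 1≤k , A3-odd k 1≤k
  where
  open FloorSums f f-floor
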